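{- Let $G=(A,B,E)$ be a bipartite graph with a proper edge coloring $\chi:E\to\{1,\dots,d\}$, $d\ge 2$, and let $G'=(A,B,E')$ be the output (for any outcome of the random choices) of either the lexicographic thinning or the reversed thinning of $G$. Then: (a) adjacent edges in $G'$ have distinct types; (b) if two edges of $G'$ meet in a vertex of $B$, they have the same class; (c) if two distinct edges $e,e'$ of $G'$ meet in a vertex of $A$, with classes $a,a'$ and types $i,i'$ respectively, and $i<i'$, then $a<a'$ and $P(a,a')=i$; (d) $G'$ (with colors from $\chi$) has no heavy path.
   Context: A bipartite graph is a triple $G=(A,B,E)$ with disjoint $A,B$ and $E\subseteq A\times B$, edges written $(x,y)$ with $x\in A$, $y\in B$. A proper edge coloring gives adjacent edges distinct colors. For distinct $a,b\in\{0,1\}^t$, $P(a,b)$ is the first position where they differ; $\{0,1\}^t$ is ordered lexicographically ($a<b$ iff $a$ has $0$ at position $P(a,b)$). A heavy path is a path $v_0v_1v_2v_3$ with $v_0\in B$ and colors $c_1=\chi(v_0v_1),c_2=\chi(v_1v_2),c_3=\chi(v_2v_3)$ satisfying $c_2<c_1\le c_3$. Thinning procedures: let $t=\lceil (\log_2 d)/2\rceil+1$ and let $H$ be the set of triples $(a,i,z)$ with $a\in\{0,1\}^t$, $i\in\{2,\dots,t\}$, $z\in\{1,\dots,2^i\}$, and $a$ having $0$ in position $i$. In lexicographic thinning $H$ is ordered by $(a,i,z)<(b,j,s)$ iff $a<b$, or $a=b$ and $i<j$, or $(a,i)=(b,j)$ and $z<s$; in reversed thinning by $(a,i,z)<(b,j,s)$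 iff $a<b$, or $a=b$ and $i>j$, or $(a,i)=(b,j)$ and $z<s$. A random map $F:\{1,\dots,d\}\to H$ is chosen: $F(1)$ is uniform among elements $(a,i,z)\in H$ whose $a$ has first bit $0$, and $F(k)$ is the successor of $F(k-1)$ in $H$ for $2\le k\le d$. An edge $e$ with $F(\chi(e))=(a,i,z)$ has class $a$ and type $i$. Independently uniform random strings $a_x\in\{0,1\}^t$ are chosen for all vertices $x\in A\cup B$. An edge $e=(x,y)$ of class $a$ and type $i$ is eligible if $a=a_y<a_x$ and $P(a,a_x)=i$. $E'$ consists of the eligible edges not adjacent to another eligible edge of the same type. -}

module Defs where

open import Data.Nat using (ℕ; zero; suc; _≤_; _<_; _>_; _^_; _∸_; ⌈_/2⌉)
open import Data.Nat.Logarithm using (⌈log₂_⌉)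
open import Data.Bool using (Bool; true; false)
open import Data.Bool.Properties using () renaming (_≟_ to _≟ᵇ_)
open import Data.Vec using (Vec; []; _∷_)
open import Data.Fin using (Fin)
open import Data.Product using (_×_; _,_)
open import Data.Sum using (_⊎_)
open import Relation.Binary.PropositionalEquality using (_≡_; _≢_)
open import Relation.Nullary using (¬_; yes; no)

-- Binary strings {0,1}^t  (0 = false, 1 = true), positions 1-indexed

Bits : ℕ → Set
Bits t = Vec Bool t

-- bit of a at position i (1 ≤ i ≤ t); returns false outside that range
-- (never used there)
bitAt : ∀ {t} → Bits t → ℕ → Bool
bitAt []       _             = false
bitAt (x ∷ xs) zero          = false
bitAt (x ∷ xs) (suc zero)    = x
bitAt (x ∷ xs) (suc (suc i)) = bitAt xs (suc i)

-- P a b : the first position (1-indexed) where a and b differ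
-- (value 0 if a ≡ b; only used for distinct a, b)
P : ∀ {t} → Bits t → Bits t → ℕ
P [] [] = 0
P (x ∷ xs) (y ∷ ys) with x ≟ᵇ y | P xs ys
... | no _  | _     = 1
... | yes _ | zero  = 0
... | yes _ | suc k = suc (suc k)

_<ˡ_ : ∀ {t} → Bits t → Bits t → Set
a <ˡ b = (a ≢ b) × (bitAt a (P a b) ≡ false)

record Triple (t : ℕ) : Set where
  constructor ⟨_,_,_⟩
  field
    cls : Bits t
    typ : ℕ
    idx : ℕ
open Triple public

InH : ∀ {t} → Triple t → Set
InH {t} ⟨ a , i , z ⟩ =
  (2 ≤ i) × (i ≤ t) × (1 ≤ z) × (z ≤ 2 ^ i) × (bitAt a i ≡ false)

data Thinning : Set where
  lexicographic reversed : Thinning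

_≺[_]_ : ∀ {t} → Triple t → Thinning → Triple t → Set
⟨ a , i , z ⟩ ≺[ lexicographic ] ⟨ b , j , s ⟩ =
  (a <ˡ b) ⊎ ((a ≡ b) × (i < j)) ⊎ ((a ≡ b) × (i ≡ j) × (z < s))
⟨ a , i , z ⟩ ≺[ reversed ] ⟨ b , j , s ⟩ =
  (a <ˡ b) ⊎ ((a ≡ b) × (i > j)) ⊎ ((a ≡ b) × (i ≡ j) × (z < s))

IsSuccessor : ∀ {t} → Thinning → Triple t → Triple t → Set
IsSuccessor {t} θ h h' =
  InH h' × (h ≺[ θ ] h') × (∀ (g : Triple t) → InH g → h ≺[ θ ] g → ¬ (g ≺[ θ ] h'))

-- t = ⌈(log₂ d)/2⌉ + 1   (note ⌈x/2⌉ = ⌈⌈x⌉/2⌉ for real x)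
tOf : ℕ → ℕ
tOf d = suc ⌈ ⌈log₂ d ⌉ /2⌉

-- F : {1..d} → H is a possible outcome of the random map of thinning θ:
-- F(1) ∈ H with class starting with bit 0, F(k) successor of F(k-1)
ThinningMap : ∀ {t} → Thinning → ℕ → (ℕ → Triple t) → Set
ThinningMap θ d F =
  InH (F 1) × (bitAt (cls (F 1)) 1 ≡ false)
  × (∀ k → 2 ≤ k → k ≤ d → IsSuccessor θ (F (k ∸ 1)) (F k))

Adjacent : ∀ {m n} → Fin m → Fin n → Fin m → Fin n → Set
Adjacent x y x' y' = ((x ≡ x') × (y ≢ y')) ⊎ ((y ≡ y') × (x ≢ x'))

ProperColoring : ∀ {m n} → ℕ → (Fin m → Fin n → Bool) → (Fin m → Fin n → ℕ) → Set
ProperColoring {m} {n} d E χ =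
  (∀ x y → E x y ≡ true → (1 ≤ χ x y) × (χ x y ≤ d))
  × (∀ (x x' : Fin m) (y y' : Fin n) → E x y ≡ true → E x' y' ≡ true →
       Adjacent x y x' y' → χ x y ≢ χ x' y')

module Thin {m n t : ℕ}
  (E : Fin m → Fin n → Bool) (χ : Fin m → Fin n → ℕ)
  (F : ℕ → Triple t) (sA : Fin m → Bits t) (sB : Fin n → Bits t) where

  class : Fin m → Fin n → Bits t
  class x y = cls (F (χ x y))

  type : Fin m → Fin n → ℕ
  type x y = typ (F (χ x y))

  Eligible : Fin m → Fin n → Set
  Eligible x y = (E x y ≡ true) × (class x y ≡ sB y) × (class x y <ˡ sA x)
                 × (P (class x y) (sA x) ≡ type x y)

  E′ : Fin m → Fin n → Set
  E′ x y = Eligible x y ×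
    (∀ x' y' → Adjacent x y x' y' → Eligible x' y' → type x' y' ≢ type x y)

  HeavyPath : Fin n → Fin m → Fin n → Fin m → Set
  HeavyPath v0 v1 v2 v3 =
    (v0 ≢ v2) × (v1 ≢ v3) × E′ v1 v0 × E′ v1 v2 × E′ v3 v2
    × (χ v1 v2 < χ v1 v0) × (χ v1 v0 ≤ χ v3 v2)

module Submission where

-- The order-theoretic core is the relation  a <ˡ[ i ] b : "a precedes b
-- lexicographically and they first differ at position i", given as an
-- inductive family.  Its key property is the
-- "common upper bound" lemma: if a <ˡ[ i ] s and b <ˡ[ j ] s with i < j then
-- a <ˡ[ i ] b (a and b agree with s before i, and at i only b agrees with s).
--
-- An eligible edge (x,y) of class a and type i satisfies a <ˡ[ i ] s_x, so
-- (c) is the common-upper-bound lemma at the vertex x; (a) and (b) are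
-- immediate from the definition of E′.  For (d) we also use that classes are
-- monotone in the colour, because F walks upwards through the order on H.
-- A heavy path v0v1v2v3 then contradicts (a), (b), (c) and monotonicity,
-- according as the types of v1v0 and v1v2 are equal, increasing or decreasing.

open import Defs
open import Data.Nat using (ℕ; zero; suc; _≤_; _<_; _∸_; _≤′_; ≤′-reflexive; ≤′-step; s≤s)
open import Data.Nat.Properties using (<-cmp; <⇒≤; ≤-trans; ≤⇒≤′; ≤′⇒≤)
open import Data.Bool using (Bool; true; false)
open import Data.Fin using (Fin)
open import Data.Vec using ([]; _∷_)
open import Data.Product using (_×_; _,_; proj₁; proj₂; ∃)
open import Data.Sum using (_⊎_; inj₁; inj₂)
open import Data.Empty using (⊥-elim)
open import Relation.Binary using (tri<; tri≈; tri>)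
open import Relation.Binary.PropositionalEquality
  using (_≡_; _≢_; refl; sym; trans; cong; subst)
open import Relation.Nullary using (¬_)

data _<ˡ[_]_ : ∀ {t} → Bits t → ℕ → Bits t → Set where
  here  : ∀ {t} {xs ys : Bits t} → (false ∷ xs) <ˡ[ 1 ] (true ∷ ys)
  there : ∀ {t} {x} {xs ys : Bits t} {k} →
          xs <ˡ[ suc k ] ys → (x ∷ xs) <ˡ[ suc (suc k) ] (x ∷ ys)

P≡0⇒≡ : ∀ {t} (a b : Bits t) → P a b ≡ 0 → a ≡ b
P≡0⇒≡ []          []          _ = refl
P≡0⇒≡ (false ∷ a) (false ∷ b) _ with P a b in eq
... | zero = cong (false ∷_) (P≡0⇒≡ a b eq)
P≡0⇒≡ (true  ∷ a) (true  ∷ b) _ with P a b in eq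
... | zero = cong (true ∷_) (P≡0⇒≡ a b eq)

tail-<ˡ : ∀ {t} {x} {a b : Bits t} {k} → P a b ≡ suc k →
          (x ∷ a) ≢ (x ∷ b) → bitAt a (suc k) ≡ false → a <ˡ b
tail-<ˡ {a = a} eq ne bit = (λ { refl → ne refl }) , subst (λ i → bitAt a i ≡ false) (sym eq) bit

<ˡ⇒<ˡ[P] : ∀ {t} (a b : Bits t) → a <ˡ b → a <ˡ[ P a b ] b
<ˡ⇒<ˡ[P] []          []          (ne , _) = ⊥-elim (ne refl)
<ˡ⇒<ˡ[P] (false ∷ a) (true  ∷ b) _        = here
<ˡ⇒<ˡ[P] (true  ∷ a) (false ∷ b) (_ , ())
<ˡ⇒<ˡ[P] (false ∷ a) (false ∷ b) (ne , bit) with P a b in eq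
... | zero  = ⊥-elim (ne (cong (false ∷_) (P≡0⇒≡ a b eq)))
... | suc k = there (subst (a <ˡ[_] b) eq (<ˡ⇒<ˡ[P] a b (tail-<ˡ eq ne bit)))
<ˡ⇒<ˡ[P] (true  ∷ a) (true  ∷ b) (ne , bit) with P a b in eq
... | zero  = ⊥-elim (ne (cong (true ∷_) (P≡0⇒≡ a b eq)))
... | suc k = there (subst (a <ˡ[_] b) eq (<ˡ⇒<ˡ[P] a b (tail-<ˡ eq ne bit)))

<ˡ[]⇒<ˡ : ∀ {t} {a b : Bits t} {i} → a <ˡ[ i ] b → (a <ˡ b) × (P a b ≡ i)
<ˡ[]⇒<ˡ here = ((λ ()) , refl) , refl
<ˡ[]⇒<ˡ (there {x = false} l) with <ˡ[]⇒<ˡ l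
... | (ne , bit) , P≡k rewrite P≡k = ((λ { refl → ne refl }) , bit) , refl
<ˡ[]⇒<ˡ (there {x = true}  l) with <ˡ[]⇒<ˡ l
... | (ne , bit) , P≡k rewrite P≡k = ((λ { refl → ne refl }) , bit) , refl

<ˡ[]-asym : ∀ {t} {a b : Bits t} {i j} → a <ˡ[ i ] b → ¬ (b <ˡ[ j ] a)
<ˡ[]-asym (there l) (there l') = <ˡ[]-asym l l'

<ˡ[]-trans : ∀ {t} {a b c : Bits t} {i j} → a <ˡ[ i ] b → b <ˡ[ j ] c → ∃ λ k → a <ˡ[ k ] c
<ˡ[]-trans here      (there _) = 1 , here
<ˡ[]-trans (there _) here      = 1 , here
<ˡ[]-trans (there l) (there l') with <ˡ[]-trans l l'
... | suc k , r = suc (suc k) , there r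

common-upper-bound : ∀ {t} {a b s : Bits t} {i j} →
  a <ˡ[ i ] s → b <ˡ[ j ] s → i < j → a <ˡ[ i ] b
common-upper-bound here      here       (s≤s ())
common-upper-bound here      (there _) _           = here
common-upper-bound (there l) (there l') (s≤s i<j) = there (common-upper-bound l l' i<j)

_≤ˡ_ : ∀ {t} → Bits t → Bits t → Set
a ≤ˡ b = (a ≡ b) ⊎ (∃ λ i → a <ˡ[ i ] b)

≤ˡ-trans : ∀ {t} {a b c : Bits t} → a ≤ˡ b → b ≤ˡ c → a ≤ˡ c
≤ˡ-trans (inj₁ refl)    q              = q
≤ˡ-trans (inj₂ p)       (inj₁ refl)    = inj₂ p
≤ˡ-trans (inj₂ (_ , p)) (inj₂ (_ , q)) = inj₂ (<ˡ[]-trans p q)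

<ˡ[]-≤ˡ-contra : ∀ {t} {a b : Bits t} {i} → a <ˡ[ i ] b → ¬ (b ≤ˡ a)
<ˡ[]-≤ˡ-contra (there l) (inj₁ refl)     = <ˡ[]-≤ˡ-contra l (inj₁ refl)
<ˡ[]-≤ˡ-contra l         (inj₂ (_ , l')) = <ˡ[]-asym l l'

≺⇒cls-≤ˡ : ∀ {t} θ {h h' : Triple t} → h ≺[ θ ] h' → cls h ≤ˡ cls h'
≺⇒cls-≤ˡ lexicographic (inj₁ lt)              = inj₂ (_ , <ˡ⇒<ˡ[P] _ _ lt)
≺⇒cls-≤ˡ lexicographic (inj₂ (inj₁ (e , _))) = inj₁ e
≺⇒cls-≤ˡ lexicographic (inj₂ (inj₂ (e , _))) = inj₁ e
≺⇒cls-≤ˡ reversed      (inj₁ lt)              = inj₂ (_ , <ˡ⇒<ˡ[P] _ _ lt)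
≺⇒cls-≤ˡ reversed      (inj₂ (inj₁ (e , _))) = inj₁ e
≺⇒cls-≤ˡ reversed      (inj₂ (inj₂ (e , _))) = inj₁ e

class-monotone : ∀ {t} θ d (F : ℕ → Triple t) →
  (∀ k → 2 ≤ k → k ≤ d → F (k ∸ 1) ≺[ θ ] F k) →
  ∀ {k l} → 1 ≤ k → k ≤′ l → l ≤ d → cls (F k) ≤ˡ cls (F l)
class-monotone θ d F step 1≤k (≤′-reflexive refl) _ = inj₁ refl
class-monotone θ d F step 1≤k (≤′-step {l} k≤′l) l<d =
  ≤ˡ-trans (class-monotone θ d F step 1≤k k≤′l (<⇒≤ l<d))
           (≺⇒cls-≤ˡ θ (step (suc l) (s≤s (≤-trans 1≤k (≤′⇒≤ k≤′l))) l<d))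

module ThinnedGraph {m n t : ℕ}
  (E : Fin m → Fin n → Bool) (χ : Fin m → Fin n → ℕ)
  (F : ℕ → Triple t) (sA : Fin m → Bits t) (sB : Fin n → Bits t) where

  open Thin E χ F sA sB

  E′⇒below : ∀ {x y} → E′ x y → class x y <ˡ[ type x y ] sA x
  E′⇒below ((_ , _ , lt , P≡type) , _) =
    subst (_ <ˡ[_] _) P≡type (<ˡ⇒<ˡ[P] _ _ lt)

  distinct-types : ∀ x y x' y' → E′ x y → E′ x' y' →
    Adjacent x y x' y' → type x y ≢ type x' y'
  distinct-types x y x' y' (_ , unique) (eligible' , _) adj eq =
    unique x' y' adj eligible' (sym eq)

  same-class-at-B : ∀ x x' y → x ≢ x' → E′ x y → E′ x' y → class x y ≡ class x' y
  same-class-at-B x x' y _ ((_ , c≡sB , _) , _) ((_ , c'≡sB , _) , _) =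
    trans c≡sB (sym c'≡sB)

  order-at-A : ∀ x y y' → y ≢ y' → E′ x y → E′ x y' → type x y < type x y' →
    (class x y <ˡ class x y') × (P (class x y) (class x y') ≡ type x y)
  order-at-A x y y' _ e e' i<i' =
    <ˡ[]⇒<ˡ (common-upper-bound (E′⇒below e) (E′⇒below e') i<i')

  no-heavy-path :
    (∀ {x y x' y'} → E′ x y → E′ x' y' → χ x y ≤ χ x' y' → class x y ≤ˡ class x' y') →
    ∀ v0 v1 v2 v3 → ¬ HeavyPath v0 v1 v2 v3
  no-heavy-path mono v0 v1 v2 v3 (v0≢v2 , v1≢v3 , e10 , e12 , e32 , c2<c1 , c1≤c3)
    with <-cmp (type v1 v0) (type v1 v2)
  ... | tri≈ _ i≡i' _ = distinct-types v1 v0 v1 v2 e10 e12 (inj₁ (refl , v0≢v2)) i≡i'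
  ... | tri< i<i' _ _ =
    -- class v1v0 < class v1v2, yet c2 < c1 forces class v1v2 ≤ class v1v0
    <ˡ[]-≤ˡ-contra (common-upper-bound (E′⇒below e10) (E′⇒below e12) i<i')
                   (mono e12 e10 (<⇒≤ c2<c1))
  ... | tri> _ _ i>i' =
    -- class v1v2 < class v1v0 ≤ class v3v2 = class v1v2
    <ˡ[]-≤ˡ-contra (common-upper-bound (E′⇒below e12) (E′⇒below e10) i>i')
                   (≤ˡ-trans (mono e10 e32 c1≤c3)
                             (inj₁ (sym (same-class-at-B v1 v3 v2 v1≢v3 e12 e32))))

lemma3 : (m n d : ℕ) → 2 ≤ d
    → (E : Fin m → Fin n → Bool) (χ : Fin m → Fin n → ℕ) → ProperColoring d E χ
    → (θ : Thinning)
    → (F : ℕ → Triple (tOf d)) → ThinningMap θ d F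
    → (sA : Fin m → Bits (tOf d)) (sB : Fin n → Bits (tOf d))
    → let open Thin E χ F sA sB in
      (∀ x y x' y' → E′ x y → E′ x' y' → Adjacent x y x' y' → type x y ≢ type x' y')
      × (∀ x x' y → x ≢ x' → E′ x y → E′ x' y → class x y ≡ class x' y)
      × (∀ x y y' → y ≢ y' → E′ x y → E′ x y' → type x y < type x y'
           → (class x y <ˡ class x y') × (P (class x y) (class x y') ≡ type x y))
      × (∀ v0 v1 v2 v3 → ¬ HeavyPath v0 v1 v2 v3)
lemma3 m n d _ E χ (inRange , _) θ F (_ , _ , successor) sA sB =
  distinct-types , same-class-at-B , order-at-A , no-heavy-path colour-monotone
  where
  open Thin E χ F sA sB
  open ThinnedGraph E χ F sA sB

  -- Colours of G′-edges lie in {1..d}, where F climbs the order on H.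
  colour-monotone : ∀ {x y x' y'} → E′ x y → E′ x' y' → χ x y ≤ χ x' y' →
                    class x y ≤ˡ class x' y'
  colour-monotone {x} {y} {x'} {y'} ((inE , _) , _) ((inE' , _) , _) c≤c' =
    class-monotone θ d F (λ k 2≤k k≤d → proj₁ (proj₂ (successor k 2≤k k≤d)))
      (proj₁ (inRange x y inE)) (≤⇒≤′ c≤c') (proj₂ (inRange x' y' inE'))
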